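{- Let $q \geqslant 2$ be an integer and $\alpha_1, \ldots, \alpha_q$ arbitrary complex numbers. Then for every integer $r$ with $1 \leqslant r < q$, $$\sum_{s=1}^q 2^{q-s}(-1)^{s-1}\sum_{1\leqslant k_1<\cdots<k_s\leqslant q}\ \sum_{\substack{\varepsilon_i\in\{ -1,+1\}\\ 2\leqslant i\leqslant s}} \bigl(\alpha_{k_1} + \varepsilon_2\alpha_{k_2} + \cdots + \varepsilon_s\alpha_{k_s}\bigr)^{2r} = 0.$$
   Context: For $s=1$ the inner sum over $\varepsilon$ is empty-indexed and consists of the single term $\alpha_{k_1}^{2r}$. -}

module Defs where

open import Level using (Level)
open import Data.Nat using (ℕ; zero; suc; _∸_) renaming (_*_ to _*ℕ_)
open import Data.Fin using (Fin)
open import Data.List as List using (List; []; _∷_; _++_; map; length; allFin; concatMap)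
open import Data.Vec as Vec using (Vec; []; _∷_)
open import Data.Sign using (Sign) renaming (+ to plus; - to minus)
open import Algebra.Bundles using (CommutativeRing)

-- all sublists of a list (order preserved); applied to allFin q = [0,…,q-1]
-- these are exactly the strictly increasing tuples k₁ < ⋯ < kₛ
sublists : ∀ {a} {A : Set a} → List A → List (List A)
sublists []       = [] ∷ []
sublists (x ∷ xs) = map (x ∷_) (sublists xs) ++ sublists xs

allSigns : (n : ℕ) → List (Vec Sign n)
allSigns zero    = [] ∷ []
allSigns (suc n) = concatMap (λ v → (plus ∷ v) ∷ (minus ∷ v) ∷ []) (allSigns n)

module _ {c ℓ : Level} (R : CommutativeRing c ℓ) where
  open CommutativeRing R

  sumR : List Carrier → Carrier
  sumR = List.foldr _+_ 0#

  powR : Carrier → ℕ → Carrier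
  powR x zero    = 1#
  powR x (suc n) = x * powR x n

  two : Carrier
  two = 1# + 1#

  signedLin : ∀ {n} → Carrier → Vec Sign n → Vec Carrier n → Carrier
  signedLin a []            []       = a
  signedLin a (plus ∷ es)   (b ∷ bs) = signedLin (a + b) es bs
  signedLin a (minus ∷ es)  (b ∷ bs) = signedLin (a - b) es bs

  innerSum : ∀ {q} → (Fin q → Carrier) → ℕ → List (Fin q) → Carrier
  innerSum α r []        = 0#
  innerSum α r (k ∷ ks)  =
    sumR (map (λ ε → powR (signedLin (α k) ε (Vec.map α (Vec.fromList ks))) (2 *ℕ r))
              (allSigns (length ks)))

  coeff : ℕ → ℕ → Carrier
  coeff q s = powR two (q ∸ s) * powR (- 1#) (s ∸ 1)

  -- Σ_{s=1}^{q} 2^{q-s}(-1)^{s-1} Σ_{k₁<⋯<kₛ} Σ_ε (…)^{2r}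
  -- (the empty tuple, s = 0, contributes innerSum = 0#, so it is harmless)
  bigSum : (q : ℕ) → (Fin q → Carrier) → ℕ → Carrier
  bigSum q α r =
    sumR (map (λ ks → coeff q (length ks) * innerSum α r ks) (sublists (allFin q)))

{-# OPTIONS --safe #-}
-- Put F x = x ^ 2r: an even function with F 0 = 0 which, measured by finite differences, is a
-- polynomial of degree 2r.  Let ∇ₐ = Δ₋ₐ ∘ Δₐ, i.e. (∇ₐ f) x = 2 f x − f (x + a) − f (x − a); it lowers
-- the degree by 2.  Multiplying out ∇_{α k₂} ⋯ ∇_{α k_q} F gives exactly the sign sums of the statement,
-- and splitting the index sets by whether they contain k₁ shows that the whole alternating sum equals
-- (∇_{α k₂} ⋯ ∇_{α k_q} F) (α k₁) − (∇_{α k₂} ⋯ ∇_{α k_q} F) 0.  As q − 1 ≥ r, this iterated difference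
-- of F is constant, so the sum vanishes; nothing is divided, so this works in every commutative ring.
module Submission where

open import Defs
open import Level using (Level; _⊔_)
open import Data.Nat using (ℕ; zero; suc; _∸_; _≤_; _<_; _≤′_; ≤′-refl; ≤′-step; z≤n; s≤s)
  renaming (_*_ to _*ℕ_; _+_ to _+ℕ_)
open import Data.Nat.Properties
  using (+-∸-assoc; *-suc; +-monoʳ-≤; *-monoʳ-≤; m≤n⇒m≤1+n; ≤⇒≤′) renaming (+-identityʳ to +ℕ-identityʳ)
open import Data.Nat.Tactic.RingSolver using (solve-∀)
open import Data.Fin using (Fin)
open import Data.List using (List; []; _∷_; _++_; map; length; allFin; concatMap)
open import Data.List.Properties using (map-∘; length-tabulate)
open import Data.List.Relation.Unary.All as All using (All; []; _∷_)
open import Data.List.Relation.Unary.All.Properties using (++⁺; map⁺)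
open import Data.Vec as Vec using (Vec; _∷_)
open import Data.Sign using (Sign) renaming (+ to plus; - to minus)
open import Algebra.Bundles using (CommutativeRing)
open import Relation.Binary.Core using (_Preserves_⟶_)
open import Relation.Binary.PropositionalEquality as ≡ using (_≡_)

private
  variable
    a : Level
    A : Set a

sublists-length≤ : (xs : List A) → All (λ ks → length ks ≤ length xs) (sublists xs)
sublists-length≤ []       = z≤n ∷ []
sublists-length≤ (x ∷ xs) = ++⁺ (map⁺ (All.map s≤s (sublists-length≤ xs)))
                                (All.map m≤n⇒m≤1+n (sublists-length≤ xs))

private
  d+2[1+n]≡2+d+2n : ∀ d n → d +ℕ 2 *ℕ suc n ≡ suc (suc (d +ℕ 2 *ℕ n))
  d+2[1+n]≡2+d+2n = solve-∀

module _ {c ℓ : Level} (R : CommutativeRing c ℓ) where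
  open CommutativeRing R hiding (zero)
  open import Algebra.Properties.Ring ring
    using (-‿+-comm; -‿involutive; -‿distribˡ-*; -‿distribʳ-*; x[y-z]≈xy-xz; -0#≈0#; -1*x≈-x;
           //-rightDividesˡ; ⁻¹-anti-homo‿-)
  open import Algebra.Properties.CommutativeSemigroup +-commutativeSemigroup using (interchange)
  open import Algebra.Solver.CommutativeMonoid +-commutativeMonoid using (solve; _⊕_; _⊜_)
  open import Relation.Binary.Reasoning.Setoid setoid

  private
    2# : Carrier
    2# = two R

    infixr 8 _^_
    _^_ : Carrier → ℕ → Carrier
    _^_ = powR R

  2*x≈x+x : ∀ x → 2# * x ≈ x + x
  2*x≈x+x x = trans (distribʳ x 1# 1#) (+-cong (*-identityˡ x) (*-identityˡ x))

  ∑ : List A → (A → Carrier) → Carrier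
  ∑ xs f = sumR R (map f xs)

  syntax ∑ xs (λ x → e) = ∑[ x ∈ xs ] e

  ∑-congᴬ : ∀ {xs} {f g : A → Carrier} → All (λ x → f x ≈ g x) xs → ∑ xs f ≈ ∑ xs g
  ∑-congᴬ []       = refl
  ∑-congᴬ (p ∷ ps) = +-cong p (∑-congᴬ ps)

  ∑-cong : ∀ xs {f g : A → Carrier} → (∀ x → f x ≈ g x) → ∑ xs f ≈ ∑ xs g
  ∑-cong []       f≈g = refl
  ∑-cong (x ∷ xs) f≈g = +-cong (f≈g x) (∑-cong xs f≈g)

  ∑-++ : ∀ xs ys (f : A → Carrier) → ∑ (xs ++ ys) f ≈ ∑ xs f + ∑ ys f
  ∑-++ []       ys f = sym (+-identityˡ _)
  ∑-++ (x ∷ xs) ys f = trans (+-congˡ (∑-++ xs ys f)) (sym (+-assoc _ _ _))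

  ∑-+ : ∀ xs (f g : A → Carrier) → ∑[ x ∈ xs ] (f x + g x) ≈ ∑ xs f + ∑ xs g
  ∑-+ []       f g = sym (+-identityˡ 0#)
  ∑-+ (x ∷ xs) f g = trans (+-congˡ (∑-+ xs f g)) (interchange _ _ _ _)

  ∑-neg : ∀ xs (f : A → Carrier) → ∑[ x ∈ xs ] (- f x) ≈ - ∑ xs f
  ∑-neg []       f = sym -0#≈0#
  ∑-neg (x ∷ xs) f = trans (+-congˡ (∑-neg xs f)) (-‿+-comm _ _)

  ∑-*ˡ : ∀ k xs (f : A → Carrier) → ∑[ x ∈ xs ] (k * f x) ≈ k * ∑ xs f
  ∑-*ˡ k []       f = sym (zeroʳ k)
  ∑-*ˡ k (x ∷ xs) f = trans (+-congˡ (∑-*ˡ k xs f)) (sym (distribˡ k _ _))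

  ∑-sublists-∷ : ∀ x xs (f : List A → Carrier) →
    ∑ (sublists (x ∷ xs)) f ≈ ∑[ ks ∈ sublists xs ] f (x ∷ ks) + ∑ (sublists xs) f
  ∑-sublists-∷ x xs f = trans (∑-++ (map (x ∷_) (sublists xs)) (sublists xs) f)
    (+-congʳ (reflexive (≡.cong (sumR R) (≡.sym (map-∘ {g = f} {f = x ∷_} (sublists xs))))))

  coeff-suc : ∀ {n s} → s ≤ n → coeff R (suc n) s ≈ 2# * coeff R n s
  coeff-suc {n} {s} s≤n = begin
    2# ^ (suc n ∸ s) * (- 1#) ^ (s ∸ 1)      ≡⟨ ≡.cong (λ m → 2# ^ m * (- 1#) ^ (s ∸ 1)) (+-∸-assoc 1 s≤n) ⟩
    (2# * 2# ^ (n ∸ s)) * (- 1#) ^ (s ∸ 1)   ≈⟨ *-assoc _ _ _ ⟩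
    2# * coeff R n s                        ∎

  coeff-suc-suc : ∀ n s → coeff R (suc n) (suc (suc s)) ≈ - coeff R n (suc s)
  coeff-suc-suc n s = begin
    2# ^ (n ∸ suc s) * (- 1# * (- 1#) ^ s)   ≈⟨ *-congˡ (-1*x≈-x _) ⟩
    2# ^ (n ∸ suc s) * - ((- 1#) ^ s)        ≈⟨ sym (-‿distribʳ-* _ _) ⟩
    - coeff R n (suc s)                     ∎

  ∑-sublists-coeff-suc : ∀ m xs (h : List A → Carrier) →
    ∑[ ks ∈ sublists xs ] (coeff R (suc (m +ℕ length xs)) (m +ℕ length ks) * h ks)
      ≈ 2# * ∑[ ks ∈ sublists xs ] (coeff R (m +ℕ length xs) (m +ℕ length ks) * h ks)
  ∑-sublists-coeff-suc m xs h = trans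
    (∑-congᴬ (All.map (λ le → trans (*-congʳ (coeff-suc (+-monoʳ-≤ m le))) (*-assoc _ _ _))
                      (sublists-length≤ xs)))
    (∑-*ˡ 2# (sublists xs) _)

  Δ : Carrier → (Carrier → Carrier) → Carrier → Carrier
  Δ a f x = f (x + a) - f x

  -- All d-fold differences of f vanish: f is a polynomial function of degree < d (degree < 0 means f ≈ 0).
  Degree< : ℕ → (Carrier → Carrier) → Set (c ⊔ ℓ)
  Degree< zero    f = ∀ x → f x ≈ 0#
  Degree< (suc d) f = ∀ a → Degree< d (Δ a f)

  Degree<-resp : ∀ d {f g} → (∀ x → f x ≈ g x) → Degree< d f → Degree< d g
  Degree<-resp zero    f≈g deg x = trans (sym (f≈g x)) (deg x)
  Degree<-resp (suc d) f≈g deg a = Degree<-resp d (λ x → +-cong (f≈g (x + a)) (-‿cong (f≈g x))) (deg a)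

  Degree<-+ : ∀ d {f g} → Degree< d f → Degree< d g → Degree< d (λ x → f x + g x)
  Degree<-+ zero    degf degg x = trans (+-cong (degf x) (degg x)) (+-identityˡ 0#)
  Degree<-+ (suc d) {f} {g} degf degg a = Degree<-resp d (λ x → sym (Δ-+ x)) (Degree<-+ d (degf a) (degg a))
    where
    Δ-+ : ∀ x → Δ a (λ y → f y + g y) x ≈ Δ a f x + Δ a g x
    Δ-+ x = trans (+-congˡ (sym (-‿+-comm _ _))) (interchange _ _ _ _)

  Degree<-*ˡ : ∀ d k {f} → Degree< d f → Degree< d (λ x → k * f x)
  Degree<-*ˡ zero    k deg x = trans (*-congˡ (deg x)) (zeroʳ k)
  Degree<-*ˡ (suc d) k deg a = Degree<-resp d (λ x → x[y-z]≈xy-xz k _ _) (Degree<-*ˡ d k (deg a))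

  Degree<-suc : ∀ d {f} → Degree< d f → Degree< (suc d) f
  Degree<-suc zero    deg a x = trans (+-cong (deg (x + a)) (-‿cong (deg x))) (-‿inverseʳ 0#)
  Degree<-suc (suc d) deg a   = Degree<-suc d (deg a)

  Degree<-mono : ∀ {d e f} → d ≤′ e → Degree< d f → Degree< e f
  Degree<-mono ≤′-refl        deg = deg
  Degree<-mono (≤′-step d≤′e) deg = Degree<-suc _ (Degree<-mono d≤′e deg)

  [x+a]u-xv≈x[u-v]+a[u-v]+av : ∀ x a u v → (x + a) * u - x * v ≈ x * (u - v) + a * (u - v) + a * v
  [x+a]u-xv≈x[u-v]+a[u-v]+av x a u v = sym (begin
    x * (u - v) + a * (u - v) + a * v
      ≈⟨ +-congʳ (+-cong (x[y-z]≈xy-xz x u v) (x[y-z]≈xy-xz a u v)) ⟩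
    (x * u - x * v) + (a * u - a * v) + a * v
      ≈⟨ solve 5 (λ p q r s t → ((p ⊕ q) ⊕ (r ⊕ s)) ⊕ t ⊜ ((p ⊕ r) ⊕ q) ⊕ (s ⊕ t)) refl _ _ _ _ _ ⟩
    (x * u + a * u - x * v) + (- (a * v) + a * v)
      ≈⟨ +-cong (+-congʳ (sym (distribʳ u x a))) (-‿inverseˡ (a * v)) ⟩
    ((x + a) * u - x * v) + 0#
      ≈⟨ +-identityʳ _ ⟩
    (x + a) * u - x * v ∎)

  Degree<-x* : ∀ d {f} → Degree< d f → Degree< (suc d) (λ x → x * f x)
  Degree<-x* zero    deg = Degree<-suc zero (λ x → trans (*-congˡ (deg x)) (zeroʳ x))
  Degree<-x* (suc d) deg a = Degree<-resp (suc d) (λ x → sym ([x+a]u-xv≈x[u-v]+a[u-v]+av x a _ _))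
    (Degree<-+ (suc d) (Degree<-+ (suc d) (Degree<-x* d (deg a)) (Degree<-suc d (Degree<-*ˡ d a (deg a))))
                       (Degree<-*ˡ (suc d) a deg))

  Degree<-pow : ∀ n → Degree< (suc n) (λ x → x ^ n)
  Degree<-pow zero    a x = -‿inverseʳ 1#
  Degree<-pow (suc n)     = Degree<-x* (suc n) (Degree<-pow n)

  ^-congˡ : ∀ n → (λ x → x ^ n) Preserves _≈_ ⟶ _≈_
  ^-congˡ zero    x≈y = refl
  ^-congˡ (suc n) x≈y = *-cong x≈y (^-congˡ n x≈y)

  -x^2n≈x^2n : ∀ n x → (- x) ^ (2 *ℕ n) ≈ x ^ (2 *ℕ n)
  -x^2n≈x^2n zero    x = refl
  -x^2n≈x^2n (suc n) x = ≡.subst (λ m → (- x) ^ m ≈ x ^ m) (≡.sym (*-suc 2 n)) (begin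
    - x * (- x * (- x) ^ (2 *ℕ n))   ≈⟨ *-congˡ (*-congˡ (-x^2n≈x^2n n x)) ⟩
    - x * (- x * x ^ (2 *ℕ n))       ≈⟨ sym (-‿distribˡ-* _ _) ⟩
    - (x * (- x * x ^ (2 *ℕ n)))     ≈⟨ -‿cong (*-congˡ (sym (-‿distribˡ-* _ _))) ⟩
    - (x * - (x * x ^ (2 *ℕ n)))     ≈⟨ -‿cong (sym (-‿distribʳ-* _ _)) ⟩
    - - (x * (x * x ^ (2 *ℕ n)))     ≈⟨ -‿involutive _ ⟩
    x * (x * x ^ (2 *ℕ n))           ∎)

  0^2n≈0 : ∀ n → 1 ≤ n → 0# ^ (2 *ℕ n) ≈ 0#
  0^2n≈0 (suc n) _ = ≡.subst (λ m → 0# ^ m ≈ 0#) (≡.sym (*-suc 2 n)) (zeroˡ _)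

  Even : (Carrier → Carrier) → Set (c ⊔ ℓ)
  Even f = ∀ x → f (- x) ≈ f x

  ∇ : Carrier → (Carrier → Carrier) → Carrier → Carrier
  ∇ a f x = 2# * f x - f (x + a) - f (x - a)

  module _ {f : Carrier → Carrier} (f-cong : f Preserves _≈_ ⟶ _≈_) where

    ∇-cong : ∀ a → ∇ a f Preserves _≈_ ⟶ _≈_
    ∇-cong a x≈y = +-cong (+-cong (*-congˡ (f-cong x≈y)) (-‿cong (f-cong (+-congʳ x≈y))))
                          (-‿cong (f-cong (+-congʳ x≈y)))

    ∇-even : ∀ a → Even f → Even (∇ a f)
    ∇-even a f-even x = begin
      2# * f (- x) - f (- x + a) - f (- x - a)
        ≈⟨ +-cong (+-cong (*-congˡ (f-even x)) (-‿cong (f-flip (sym (-‿involutive a)))))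
                  (-‿cong (f-flip refl)) ⟩
      2# * f x - f (x - a) - f (x + a)
        ≈⟨ solve 3 (λ p q r → (p ⊕ q) ⊕ r ⊜ (p ⊕ r) ⊕ q) refl _ _ _ ⟩
      2# * f x - f (x + a) - f (x - a) ∎
      where
      f-flip : ∀ {y b} → y ≈ - b → f (- x + y) ≈ f (x + b)
      f-flip {y} {b} y≈-b = trans (f-cong (trans (+-congˡ y≈-b) (-‿+-comm x b))) (f-even (x + b))

    ∇-at-0 : ∀ a → Even f → ∇ a f 0# ≈ 2# * (f 0# - f a)
    ∇-at-0 a f-even = begin
      2# * f 0# - f (0# + a) - f (0# - a)
        ≈⟨ +-cong (+-congˡ (-‿cong (f-cong (+-identityˡ a))))
                  (-‿cong (trans (f-cong (+-identityˡ (- a))) (f-even a))) ⟩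
      2# * f 0# - f a - f a
        ≈⟨ +-assoc _ _ _ ⟩
      2# * f 0# + (- f a + - f a)
        ≈⟨ +-congˡ (sym (2*x≈x+x _)) ⟩
      2# * f 0# + 2# * - f a
        ≈⟨ sym (distribˡ 2# _ _) ⟩
      2# * (f 0# - f a) ∎

    Degree<-∇ : ∀ d a → Degree< (suc (suc d)) f → Degree< d (∇ a f)
    Degree<-∇ d a deg = Degree<-resp d ΔΔ≈∇ (deg a (- a))
      where
      ΔΔ≈∇ : ∀ x → Δ (- a) (Δ a f) x ≈ ∇ a f x
      ΔΔ≈∇ x = begin
        (f (x - a + a) - f (x - a)) - (f (x + a) - f x)
          ≈⟨ +-cong (+-congʳ (f-cong (//-rightDividesˡ a x))) (⁻¹-anti-homo‿- _ _) ⟩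
        (f x - f (x - a)) + (f x - f (x + a))
          ≈⟨ solve 4 (λ p q r s → (p ⊕ q) ⊕ (r ⊕ s) ⊜ ((p ⊕ r) ⊕ s) ⊕ q) refl _ _ _ _ ⟩
        f x + f x - f (x + a) - f (x - a)
          ≈⟨ +-congʳ (+-congʳ (sym (2*x≈x+x _))) ⟩
        ∇ a f x ∎

  module AlternatingSum {i} {I : Set i} (α : I → Carrier) (F : Carrier → Carrier)
                        (F-cong : F Preserves _≈_ ⟶ _≈_) (F-even : Even F) (F-zero : F 0# ≈ 0#) where

    signSum : Carrier → List I → Carrier
    signSum x ks = ∑[ ε ∈ allSigns (length ks) ] F (signedLin R x ε (Vec.map α (Vec.fromList ks)))

    ∑-allSigns-suc : ∀ n (G : Vec Sign (suc n) → Carrier) →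
      ∑ (allSigns (suc n)) G ≈ ∑[ ε ∈ allSigns n ] G (plus ∷ ε) + ∑[ ε ∈ allSigns n ] G (minus ∷ ε)
    ∑-allSigns-suc n G = trans (∑-pairs (allSigns n)) (∑-+ (allSigns n) _ _)
      where
      ∑-pairs : ∀ εs → ∑ (concatMap (λ ε → (plus ∷ ε) ∷ (minus ∷ ε) ∷ []) εs) G
                         ≈ ∑[ ε ∈ εs ] (G (plus ∷ ε) + G (minus ∷ ε))
      ∑-pairs []       = refl
      ∑-pairs (ε ∷ εs) = trans (+-congˡ (+-congˡ (∑-pairs εs))) (sym (+-assoc _ _ _))

    signSum-∷ : ∀ x k ks → signSum x (k ∷ ks) ≈ signSum (x + α k) ks + signSum (x - α k) ks
    signSum-∷ x k ks = ∑-allSigns-suc (length ks) _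

    firstSignSum : List I → Carrier
    firstSignSum []       = 0#
    firstSignSum (k ∷ ks) = signSum (α k) ks

    alternatingSum : List I → Carrier
    alternatingSum xs = ∑[ ks ∈ sublists xs ] (coeff R (length xs) (length ks) * firstSignSum ks)

    ∇* : List I → Carrier → Carrier
    ∇* []       = F
    ∇* (k ∷ ks) = ∇ (α k) (∇* ks)

    ∇*-cong : ∀ ks → ∇* ks Preserves _≈_ ⟶ _≈_
    ∇*-cong []       = F-cong
    ∇*-cong (k ∷ ks) = ∇-cong (∇*-cong ks) (α k)

    ∇*-even : ∀ ks → Even (∇* ks)
    ∇*-even []       = F-even
    ∇*-even (k ∷ ks) = ∇-even (∇*-cong ks) (α k) (∇*-even ks)

    Degree<-∇* : ∀ ks d → Degree< (d +ℕ 2 *ℕ length ks) F → Degree< d (∇* ks)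
    Degree<-∇* []       d deg = ≡.subst (λ e → Degree< e F) (+ℕ-identityʳ d) deg
    Degree<-∇* (k ∷ ks) d deg = Degree<-∇ (∇*-cong ks) d (α k)
      (Degree<-∇* ks (suc (suc d)) (≡.subst (λ e → Degree< e F) (d+2[1+n]≡2+d+2n d (length ks)) deg))

    -- (∏_{k ∈ xs} (2 − τ_{α k} − τ_{−α k})) F at x, multiplied out, where τ_b f = f (· + b).
    expanded : Carrier → List I → Carrier
    expanded x xs = ∑[ ks ∈ sublists xs ] (coeff R (suc (length xs)) (suc (length ks)) * signSum x ks)

    expanded-∷ : ∀ x k ks → expanded x (k ∷ ks) ≈ ∇ (α k) (λ y → expanded y ks) x
    expanded-∷ x k ks = begin
      expanded x (k ∷ ks)
        ≈⟨ ∑-sublists-∷ k ks _ ⟩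
      ∑[ ys ∈ sublists ks ] (coeff R (suc (suc n)) (suc (suc (length ys))) * signSum x (k ∷ ys))
        + ∑[ ys ∈ sublists ks ] (coeff R (suc (suc n)) (suc (length ys)) * signSum x ys)
        ≈⟨ +-cong (trans (∑-cong (sublists ks) split) (trans (∑-+ (sublists ks) _ _)
                         (+-cong (∑-neg (sublists ks) _) (∑-neg (sublists ks) _))))
                  (∑-sublists-coeff-suc 1 ks _) ⟩
      (- expanded (x + α k) ks + - expanded (x - α k) ks) + 2# * expanded x ks
        ≈⟨ solve 3 (λ p q r → (p ⊕ q) ⊕ r ⊜ (r ⊕ p) ⊕ q) refl _ _ _ ⟩
      ∇ (α k) (λ y → expanded y ks) x ∎
      where
      n : ℕ
      n = length ks
      split : ∀ ys → coeff R (suc (suc n)) (suc (suc (length ys))) * signSum x (k ∷ ys)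
                     ≈ - (coeff R (suc n) (suc (length ys)) * signSum (x + α k) ys)
                       + - (coeff R (suc n) (suc (length ys)) * signSum (x - α k) ys)
      split ys = begin
        coeff R (suc (suc n)) (suc (suc (length ys))) * signSum x (k ∷ ys)
          ≈⟨ *-cong (coeff-suc-suc (suc n) (length ys)) (signSum-∷ x k ys) ⟩
        - c′ * (signSum (x + α k) ys + signSum (x - α k) ys)
          ≈⟨ sym (-‿distribˡ-* _ _) ⟩
        - (c′ * (signSum (x + α k) ys + signSum (x - α k) ys))
          ≈⟨ -‿cong (distribˡ c′ _ _) ⟩
        - (c′ * signSum (x + α k) ys + c′ * signSum (x - α k) ys)
          ≈⟨ sym (-‿+-comm _ _) ⟩
        - (c′ * signSum (x + α k) ys) + - (c′ * signSum (x - α k) ys) ∎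
        where
        c′ : Carrier
        c′ = coeff R (suc n) (suc (length ys))

    expanded≈∇* : ∀ xs x → expanded x xs ≈ ∇* xs x
    expanded≈∇* []       x = trans (+-identityʳ _)
      (trans (*-cong (*-identityˡ 1#) (+-identityʳ (F x))) (*-identityˡ (F x)))
    expanded≈∇* (k ∷ ks) x = trans (expanded-∷ x k ks)
      (+-cong (+-cong (*-congˡ (expanded≈∇* ks x)) (-‿cong (expanded≈∇* ks _)))
              (-‿cong (expanded≈∇* ks _)))

    alternatingSum-∷ : ∀ b bs → alternatingSum (b ∷ bs) ≈ expanded (α b) bs + 2# * alternatingSum bs
    alternatingSum-∷ b bs = trans (∑-sublists-∷ b bs _) (+-congˡ (∑-sublists-coeff-suc 0 bs _))

    -- In the inductive step, 2 (∇* cs (α c) − ∇* cs 0) = − ∇* (c ∷ cs) 0 because ∇* cs is even.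
    alternatingSum≈∇*-difference : ∀ b bs → alternatingSum (b ∷ bs) ≈ ∇* bs (α b) - ∇* bs 0#
    alternatingSum≈∇*-difference b [] = begin
      alternatingSum (b ∷ [])
        ≈⟨ alternatingSum-∷ b [] ⟩
      expanded (α b) [] + 2# * (coeff R 0 0 * 0# + 0#)
        ≈⟨ +-cong (expanded≈∇* [] (α b)) (trans (*-congˡ (trans (+-identityʳ _) (zeroʳ _))) (zeroʳ 2#)) ⟩
      F (α b) + 0#
        ≈⟨ +-congˡ (sym (trans (-‿cong F-zero) -0#≈0#)) ⟩
      F (α b) - F 0# ∎
    alternatingSum≈∇*-difference b (c ∷ cs) = begin
      alternatingSum (b ∷ c ∷ cs)
        ≈⟨ alternatingSum-∷ b (c ∷ cs) ⟩
      expanded (α b) (c ∷ cs) + 2# * alternatingSum (c ∷ cs)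
        ≈⟨ +-cong (expanded≈∇* (c ∷ cs) (α b)) (*-congˡ (alternatingSum≈∇*-difference c cs)) ⟩
      ∇* (c ∷ cs) (α b) + 2# * (∇* cs (α c) - ∇* cs 0#)
        ≈⟨ +-congˡ (*-congˡ (sym (⁻¹-anti-homo‿- _ _))) ⟩
      ∇* (c ∷ cs) (α b) + 2# * - (∇* cs 0# - ∇* cs (α c))
        ≈⟨ +-congˡ (sym (-‿distribʳ-* _ _)) ⟩
      ∇* (c ∷ cs) (α b) - 2# * (∇* cs 0# - ∇* cs (α c))
        ≈⟨ +-congˡ (-‿cong (sym (∇-at-0 (∇*-cong cs) (α c) (∇*-even cs)))) ⟩
      ∇* (c ∷ cs) (α b) - ∇* (c ∷ cs) 0# ∎

    alternatingSum-vanishes : ∀ r xs → Degree< (suc (2 *ℕ r)) F → r < length xs → alternatingSum xs ≈ 0#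
    alternatingSum-vanishes r (b ∷ bs) deg (s≤s r≤n) = begin
      alternatingSum (b ∷ bs)        ≈⟨ alternatingSum≈∇*-difference b bs ⟩
      ∇* bs (α b) - ∇* bs 0#         ≈⟨ +-congʳ (∇*-cong bs (sym (+-identityˡ (α b)))) ⟩
      Δ (α b) (∇* bs) 0#             ≈⟨ Degree<-∇* bs 1 (Degree<-mono (≤⇒≤′ (s≤s (*-monoʳ-≤ 2 r≤n))) deg) (α b) 0# ⟩
      0#                             ∎

lemma2 : ∀ {c ℓ : Level} (R : CommutativeRing c ℓ) (q : ℕ) → 2 ≤ q →
           (α : Fin q → CommutativeRing.Carrier R) (r : ℕ) → 1 ≤ r → r < q →
           CommutativeRing._≈_ R (bigSum R q α r) (CommutativeRing.0# R)
lemma2 R q _ α r 1≤r r<q = trans (∑-cong R (sublists (allFin q)) (λ ks → *-congˡ (innerSum≈firstSignSum ks)))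
  (≡.subst (λ n → ∑ R (sublists (allFin q)) (λ ks → coeff R n (length ks) * firstSignSum ks) ≈ 0#) length-allFin
    (alternatingSum-vanishes r (allFin q) (Degree<-pow R (2 *ℕ r)) (≡.subst (r <_) (≡.sym length-allFin) r<q)))
  where
  open CommutativeRing R
  open AlternatingSum R α (λ x → powR R x (2 *ℕ r)) (^-congˡ R (2 *ℕ r)) (-x^2n≈x^2n R r) (0^2n≈0 R r 1≤r)

  length-allFin : length (allFin q) ≡ q
  length-allFin = length-tabulate (λ i → i)

  innerSum≈firstSignSum : ∀ ks → innerSum R α r ks ≈ firstSignSum ks
  innerSum≈firstSignSum []       = refl
  innerSum≈firstSignSum (k ∷ ks) = refl
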